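{- The relation $\preceq_\omega$ is a total preorder on $\Sigma_\$^+$, i.e., it is reflexive, transitive and connected (for all $V,U$, $V\preceq_\omega U$ or $U\preceq_\omega V$).
   Context: $\Sigma=[0..\sigma]$ is an integer alphabet, $\$\notin\Sigma$ is a symbol smaller than every integer, $\Sigma_\$=\Sigma\cup\{\$\}$, $\infty$ is a symbol larger than every integer. Strings are 1-indexed; $X[..i]=X[1..i]$, $X[i..]=X[i..|X|]$; $X^\omega$ is the infinite concatenation of $X$. Every nonempty string $X$ is $Y^k$ for a unique primitive (non-power) $Y=:\mathrm{root}(X)$ and integer $k$. For strings $U,V$, $\mathrm{lcp}(U,V)$ is the length of their longest common prefix and $U<V$ iff $U$ is a proper prefix of $V$ or $U[\ell+1]<V[\ell+1]$ with $\ell=\mathrm{lcp}(U,V)$. Parent distance encoding: $\mathrm{PD}(V)[i]=\infty$ if $V[i]\neq\$$ and $V[i]<V[j]$ for all $j<i$; $=\$$ if $V[i]=\$$; otherwise $i-\max\{j<i:V[j]\le V[i]\}$. $\mathrm{RPD}(V)=\mathrm{PD}(V^2)[|V|+1..]$. For $V,U\in\Sigma_\$^+$: $V\preceq_\omega U$ iff there exists a natural number $i$ with $\mathrm{PD}(V^\omega[..i])<\mathrm{PD}(U^\omega[..i])$, or $\mathrm{root}(\mathrm{RPD}(V))=\mathrm{root}(\mathrm{RPD}(U))$. -}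

module Defs where

open import Data.Nat using (ℕ; zero; suc; _≤_; _<_)
open import Data.Nat.Properties using (_≤?_)
open import Data.Fin using (Fin; toℕ)
open import Data.List using (List; []; _∷_; _++_; take; drop; length; concat; replicate)
open import Data.List.NonEmpty using (List⁺; toList)
open import Data.Product using (Σ; _×_; _,_; ∃-syntax)
open import Data.Sum using (_⊎_)
open import Relation.Nullary using (¬_; yes; no)
open import Relation.Binary.PropositionalEquality using (_≡_)

data Sym (σ : ℕ) : Set where
  dollar : Sym σ
  ch     : Fin (suc σ) → Sym σ

data _≤S_ {σ : ℕ} : Sym σ → Sym σ → Set where
  $≤  : ∀ {x} → dollar ≤S x
  ch≤ : ∀ {a b : Fin (suc σ)} → toℕ a ≤ toℕ b → ch a ≤S ch b

_≤S?_ : ∀ {σ} → (x y : Sym σ) → Relation.Nullary.Dec (x ≤S y)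
dollar ≤S? y = yes $≤
ch a ≤S? dollar = no (λ ())
ch a ≤S? ch b with toℕ a ≤? toℕ b
... | yes p = yes (ch≤ p)
... | no ¬p = no (λ { (ch≤ p) → ¬p p })

data PDSym : Set where
  pd$ : PDSym
  pdN : ℕ → PDSym
  pd∞ : PDSym

data _<P_ : PDSym → PDSym → Set where
  $<N : ∀ {n} → pd$ <P pdN n
  $<∞ : pd$ <P pd∞
  N<N : ∀ {m n} → m < n → pdN m <P pdN n
  N<∞ : ∀ {n} → pdN n <P pd∞

data Lex< {A : Set} (_<_ : A → A → Set) : List A → List A → Set where
  prefix : ∀ {y ys} → Lex< _<_ [] (y ∷ ys)
  here   : ∀ {x y xs ys} → x < y → Lex< _<_ (x ∷ xs) (y ∷ ys)
  there  : ∀ {x xs ys} → Lex< _<_ xs ys → Lex< _<_ (x ∷ xs) (x ∷ ys)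

-- Parent distance encoding.
-- parent rs x k : rs is the reversed prefix (nearest symbol first), k is
-- the distance of the head of rs.

parent : ∀ {σ} → List (Sym σ) → Sym σ → ℕ → PDSym
parent []       x k = pd∞
parent (r ∷ rs) x k with r ≤S? x
... | yes _ = pdN k
... | no  _ = parent rs x (suc k)

pdSym : ∀ {σ} → List (Sym σ) → Sym σ → PDSym
pdSym rs dollar = pd$
pdSym rs (ch a) = parent rs (ch a) 1

pdAcc : ∀ {σ} → List (Sym σ) → List (Sym σ) → List PDSym
pdAcc rs []       = []
pdAcc rs (x ∷ xs) = pdSym rs x ∷ pdAcc (x ∷ rs) xs

PD : ∀ {σ} → List (Sym σ) → List PDSym
PD = pdAcc []

RPD : ∀ {σ} → List (Sym σ) → List PDSym
RPD V = drop (length V) (PD (V ++ V))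

_^_ : {A : Set} → List A → ℕ → List A
X ^ k = concat (replicate k X)

-- X^ω[..i]  (for nonempty X, i copies of X are long enough)
ωprefix : {A : Set} → List⁺ A → ℕ → List A
ωprefix X i = take i (toList X ^ i)

Primitive : {A : Set} → List A → Set
Primitive {A} Y = ¬ (Y ≡ []) × (∀ (Z : List A) (k : ℕ) → 2 ≤ k → ¬ (Y ≡ Z ^ k))

-- root(X) = root(W): since the primitive root of a nonempty string is
-- unique, this says both are powers of one and the same primitive string.
SameRoot : {A : Set} → List A → List A → Set
SameRoot {A} X W =
  ∃[ Y ] Primitive Y × (∃[ k ] 1 ≤ k × X ≡ Y ^ k) × (∃[ m ] 1 ≤ m × W ≡ Y ^ m)

_⪯ω_ : ∀ {σ} → List⁺ (Sym σ) → List⁺ (Sym σ) → Set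
V ⪯ω U = (∃[ i ] Lex< _<P_ (PD (ωprefix V i)) (PD (ωprefix U i)))
       ⊎ SameRoot (RPD (toList V)) (RPD (toList U))

-- Write s_V (pdω V) for the parent-distance sequence of V^ω, so that PD(V^ω[..i]) is its length-i
-- prefix. Each position t ≥ |V| of V^ω sees its own symbol |V| places earlier, so its parent lies
-- within distance |V|; hence r_V t = s_V (|V| + t) (rpdSeq V) is |V|-periodic with period block
-- RPD(V), and s_V t is r_V t with distances beyond t replaced by ∞. For periodic sequences, equality
-- of the primitive roots of two period blocks amounts to equality of the sequences (the root of any
-- period block is the block of the least period, which divides every period), so
-- root(RPD V) = root(RPD U) iff s_V = s_U. Thus V ⪯ω U says s_V ≤ s_U in the lexicographic
-- preorder on sequences, which is reflexive and transitive; it is total because s_V = s_U already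
-- follows from agreement on the first 2|V||U| positions.
module Submission where

open import Defs
open import Data.Nat using (ℕ; zero; suc; _+_; _*_; _∸_; _≤_; _<_; _<?_; z<s; s≤s; NonZero; >-nonZero⁻¹)
open import Data.Nat.Properties
open import Data.Nat.DivMod using (_%_; _/_; m%n<n; m≡m%n+[m/n]*n; [m+n]%n≡m%n; m<n⇒m%n≡m)
open import Data.Nat.Divisibility using (_∣_; divides; quotient≢0; m%n≡0⇒n∣m)
open import Data.Nat.Induction using (<-wellFounded)
open import Data.List
  using (List; []; _∷_; _++_; _∷ʳ_; take; drop; length; applyUpTo; applyDownFrom; reverse; reverseAcc)
open import Data.List.Properties
  using (++-assoc; length-++; length-applyUpTo; length-applyDownFrom; applyUpTo-∷ʳ; reverse-applyUpTo; ∷-injective)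
open import Data.List.NonEmpty using (List⁺; _∷_; toList)
import Data.List.NonEmpty as List⁺
open import Data.List.Relation.Unary.Any using (Any)
import Data.List.Relation.Unary.Any as Any
open import Data.List.Relation.Unary.Any.Properties using (applyDownFrom⁺)
open import Data.Product using (∃-syntax; _×_; _,_; proj₁; proj₂)
open import Data.Sum using (_⊎_; inj₁; inj₂)
open import Function using (_∘_; case_of_)
open import Induction.WellFounded using (Acc; acc)
open import Relation.Nullary using (¬_; yes; no; contradiction)
open import Relation.Unary using (Decidable)
open import Relation.Binary.Definitions using (DecidableEquality; tri<; tri≈; tri>)
open import Relation.Binary.PropositionalEquality
open import Relation.Binary.Structures using (IsTotalPreorder)

least : ∀ {P : ℕ → Set} → Decidable P → ∀ {n} → P n → ∃[ d ] P d × (∀ {e} → e < d → ¬ P e)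
least {P} P? {n} = go n (<-wellFounded n)
  where
  go : ∀ n → Acc _<_ n → P n → ∃[ d ] P d × (∀ {e} → e < d → ¬ P e)
  go n (acc rec) Pn with anyUpTo? P? n
  ... | yes (m , m<n , Pm) = go m (rec m<n) Pm
  ... | no none = n , Pn , λ e<n Pe → none (_ , e<n , Pe)

module _ {A : Set} where

  applyUpTo-cong : ∀ {f g : ℕ → A} n → (∀ {j} → j < n → f j ≡ g j) →
                   applyUpTo f n ≡ applyUpTo g n
  applyUpTo-cong zero    f≡g = refl
  applyUpTo-cong (suc n) f≡g = cong₂ _∷_ (f≡g z<s) (applyUpTo-cong n (λ j<n → f≡g (s≤s j<n)))

  applyUpTo-injective : ∀ {f g : ℕ → A} n → applyUpTo f n ≡ applyUpTo g n →
                        ∀ {j} → j < n → f j ≡ g j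
  applyUpTo-injective (suc n) eq {zero}  _         = proj₁ (∷-injective eq)
  applyUpTo-injective (suc n) eq {suc j} (s≤s j<n) = applyUpTo-injective n (proj₂ (∷-injective eq)) j<n

  applyUpTo-+ : ∀ (f : ℕ → A) m n →
                applyUpTo f (m + n) ≡ applyUpTo f m ++ applyUpTo (λ j → f (m + j)) n
  applyUpTo-+ f zero    n = refl
  applyUpTo-+ f (suc m) n = cong (f 0 ∷_) (applyUpTo-+ (λ j → f (suc j)) m n)

  take-applyUpTo : ∀ (f : ℕ → A) {m n} → m ≤ n → take m (applyUpTo f n) ≡ applyUpTo f m
  take-applyUpTo f {zero}          _         = refl
  take-applyUpTo f {suc m} {suc n} (s≤s m≤n) = cong (f 0 ∷_) (take-applyUpTo (λ j → f (suc j)) m≤n)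

  drop-applyUpTo : ∀ (f : ℕ → A) m n →
                   drop m (applyUpTo f (m + n)) ≡ applyUpTo (λ j → f (m + j)) n
  drop-applyUpTo f zero    n = refl
  drop-applyUpTo f (suc m) n = drop-applyUpTo (λ j → f (suc j)) m n

  applyDownFrom-cong : ∀ {f g : ℕ → A} → f ≗ g → ∀ n → applyDownFrom f n ≡ applyDownFrom g n
  applyDownFrom-cong f≗g zero    = refl
  applyDownFrom-cong f≗g (suc n) = cong₂ _∷_ (f≗g n) (applyDownFrom-cong f≗g n)

  applyDownFrom-+ : ∀ (f : ℕ → A) m n →
                    applyDownFrom f (m + n) ≡ applyDownFrom (λ j → f (n + j)) m ++ applyDownFrom f n
  applyDownFrom-+ f zero    n = refl
  applyDownFrom-+ f (suc m) n = cong₂ _∷_ (cong f (+-comm m n)) (applyDownFrom-+ f m n)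

  ^-* : ∀ (Y : List A) a b → (Y ^ a) ^ b ≡ Y ^ (b * a)
  ^-* Y a zero    = refl
  ^-* Y a (suc b) = trans (cong (Y ^ a ++_) (^-* Y a b)) (sym (^-+ a (b * a)))
    where
    ^-+ : ∀ a b → Y ^ (a + b) ≡ Y ^ a ++ Y ^ b
    ^-+ zero    b = refl
    ^-+ (suc a) b = trans (cong (Y ++_) (^-+ a b)) (sym (++-assoc Y (Y ^ a) (Y ^ b)))

  length-^ : ∀ (Y : List A) k → length (Y ^ k) ≡ k * length Y
  length-^ Y zero    = refl
  length-^ Y (suc k) = trans (length-++ Y) (cong (length Y +_) (length-^ Y k))

  []-^ : ∀ k → ([] {A = A}) ^ k ≡ []
  []-^ zero    = refl
  []-^ (suc k) = []-^ k

  ^-≡-by-length : ∀ (Y : List A) → ¬ Y ≡ [] → ∀ a b →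
                  length (Y ^ a) ≡ length (Y ^ b) → Y ^ a ≡ Y ^ b
  ^-≡-by-length []          Y≢[] a b _   = contradiction refl Y≢[]
  ^-≡-by-length Y@(_ ∷ ys) _    a b len = cong (Y ^_) (*-cancelʳ-≡ a b (length Y) (begin
    a * length Y   ≡⟨ length-^ Y a ⟨
    length (Y ^ a) ≡⟨ len ⟩
    length (Y ^ b) ≡⟨ length-^ Y b ⟩
    b * length Y   ∎))
    where open ≡-Reasoning

  nth : A → List A → ℕ → A
  nth x []       _       = x
  nth _ (y ∷ ys) zero    = y
  nth x (y ∷ ys) (suc n) = nth x ys n

  applyUpTo-nth : ∀ x xs → applyUpTo (nth x xs) (length xs) ≡ xs
  applyUpTo-nth x []       = refl
  applyUpTo-nth x (y ∷ ys) = cong (y ∷_) (applyUpTo-nth x ys)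

  Period : (ℕ → A) → ℕ → Set
  Period f n = ∀ j → f (n + j) ≡ f j

  Period-resp-≗ : ∀ {f g : ℕ → A} {n} → f ≗ g → Period f n → Period g n
  Period-resp-≗ {f} {g} {n} f≗g f-n j = trans (sym (f≗g (n + j))) (trans (f-n j) (f≗g j))

  Period-* : ∀ {f : ℕ → A} {n} → Period f n → ∀ c → Period f (c * n)
  Period-* f-n zero    j = refl
  Period-* {f} {n} f-n (suc c) j =
    trans (cong f (+-assoc n (c * n) j)) (trans (f-n (c * n + j)) (Period-* f-n c j))

  Period-+⁻ : ∀ {f : ℕ → A} m {n} → Period f (m + n) → Period f n → Period f m
  Period-+⁻ {f} m {n} f-mn f-n j = begin
    f (m + j)       ≡⟨ f-n (m + j) ⟨
    f (n + (m + j)) ≡⟨ cong f (trans (sym (+-assoc n m j)) (cong (_+ j) (+-comm n m))) ⟩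
    f (m + n + j)   ≡⟨ f-mn j ⟩
    f j             ∎
    where open ≡-Reasoning

  Period-% : ∀ {f : ℕ → A} {n} .{{_ : NonZero n}} → Period f n → ∀ j → f j ≡ f (j % n)
  Period-% {f} {n} f-n j = begin
    f j                   ≡⟨ cong f (m≡m%n+[m/n]*n j n) ⟩
    f (j % n + j / n * n) ≡⟨ cong f (+-comm (j % n) (j / n * n)) ⟩
    f (j / n * n + j % n) ≡⟨ Period-* f-n (j / n) (j % n) ⟩
    f (j % n)             ∎
    where open ≡-Reasoning

  Period-agree : ∀ {f g : ℕ → A} {n} .{{_ : NonZero n}} → Period f n → Period g n →
                 (∀ {j} → j < n → f j ≡ g j) → f ≗ g
  Period-agree {f} {g} {n} f-n g-n f≡g j =
    trans (Period-% f-n j) (trans (f≡g (m%n<n j n)) (sym (Period-% g-n j)))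

  Period-fromBelow : ∀ {f : ℕ → A} {n} .{{_ : NonZero n}} → Period f n →
                     ∀ m → (∀ {j} → j < n → f (m + j) ≡ f j) → Period f m
  Period-fromBelow {f} {n} f-n m = Period-agree shifted-n f-n
    where
    shifted-n : Period (λ j → f (m + j)) n
    shifted-n j = trans (cong f (trans (sym (+-assoc m n j)) (trans (cong (_+ j) (+-comm m n)) (+-assoc n m j))))
                        (f-n (m + j))

  applyUpTo-* : ∀ {f : ℕ → A} {n} → Period f n → ∀ c → applyUpTo f (c * n) ≡ applyUpTo f n ^ c
  applyUpTo-* f-n zero    = refl
  applyUpTo-* {f} {n} f-n (suc c) = trans (applyUpTo-+ f n (c * n))
    (cong (applyUpTo f n ++_) (trans (applyUpTo-cong (c * n) (λ {j} _ → f-n j)) (applyUpTo-* f-n c)))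

  -- X^ω; the default handed to nth is never reached.
  cycle : List⁺ A → ℕ → A
  cycle X j = nth (List⁺.head X) (toList X) (j % length (toList X))

  cycle-period : ∀ X → Period (cycle X) (length (toList X))
  cycle-period X j = cong (nth (List⁺.head X) (toList X))
    (trans (cong (_% length (toList X)) (+-comm (length (toList X)) j)) ([m+n]%n≡m%n j (length (toList X))))

  applyUpTo-cycle : ∀ X → applyUpTo (cycle X) (length (toList X)) ≡ toList X
  applyUpTo-cycle X = trans
    (applyUpTo-cong (length (toList X)) (λ j<n → cong (nth (List⁺.head X) (toList X)) (m<n⇒m%n≡m j<n)))
    (applyUpTo-nth (List⁺.head X) (toList X))

  Period-fromPower : ∀ {f : ℕ → A} {n} .{{_ : NonZero n}} → Period f n →
                     ∀ Z k → applyUpTo f n ≡ toList Z ^ k → Period f (length (toList Z))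
  Period-fromPower {f} {n} f-n Z k f≡Zᵏ = Period-resp-≗ (λ j → sym (f≗cycle j)) (cycle-period Z)
    where
    n≡k*z : n ≡ k * length (toList Z)
    n≡k*z = trans (sym (length-applyUpTo f n)) (trans (cong length f≡Zᵏ) (length-^ (toList Z) k))
    cycle-n : Period (cycle Z) n
    cycle-n = subst (Period (cycle Z)) (sym n≡k*z) (Period-* (cycle-period Z) k)
    cycle≡Zᵏ : applyUpTo (cycle Z) n ≡ toList Z ^ k
    cycle≡Zᵏ = trans (cong (applyUpTo (cycle Z)) n≡k*z)
                     (trans (applyUpTo-* (cycle-period Z) k) (cong (_^ k) (applyUpTo-cycle Z)))
    f≗cycle : f ≗ cycle Z
    f≗cycle = Period-agree f-n cycle-n (applyUpTo-injective n (trans f≡Zᵏ (sym cycle≡Zᵏ)))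

module LeastPeriod {A : Set} (_≟_ : DecidableEquality A) {f : ℕ → A} {p : ℕ} .{{_ : NonZero p}}
                   (f-p : Period f p) where

  -- Checking one p-block suffices (Period-fromBelow), so this is decidable.
  PeriodBelow : ℕ → Set
  PeriodBelow d = ∀ {j} → j < p → f (suc d + j) ≡ f j

  minimal : ∃[ d ] PeriodBelow d × (∀ {e} → e < d → ¬ PeriodBelow e)
  minimal = least (λ d → allUpTo? (λ j → f (suc d + j) ≟ f j) p)
                  (λ {j} _ → trans (cong (λ n → f (n + j)) (suc-pred p)) (f-p j))

  period : ℕ
  period = suc (proj₁ minimal)

  period-period : Period f period
  period-period = Period-fromBelow f-p period (proj₁ (proj₂ minimal))

  period-minimal : ∀ {e} → suc e < period → ¬ Period f (suc e)
  period-minimal (s≤s e<d) f-e = proj₂ (proj₂ minimal) e<d (λ {j} _ → f-e j)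

  period-∣ : ∀ {m} → Period f m → period ∣ m
  period-∣ {m} f-m = m%n≡0⇒n∣m m period (m%period≡0 (m % period) refl)
    where
    f-m%d : Period f (m % period)
    f-m%d = Period-+⁻ (m % period) (subst (Period f) (m≡m%n+[m/n]*n m period) f-m)
                                   (Period-* period-period (m / period))
    m%period≡0 : ∀ r → m % period ≡ r → r ≡ 0
    m%period≡0 zero    _  = refl
    m%period≡0 (suc r) eq = contradiction (subst (Period f) eq f-m%d)
                                          (period-minimal (subst (_< period) eq (m%n<n m period)))

  root : List A
  root = applyUpTo f period

  root≢[] : ¬ root ≡ []
  root≢[] ()

  root-primitive : Primitive root
  root-primitive = root≢[] , not-power
    where
    not-power : ∀ Z k → 2 ≤ k → ¬ root ≡ Z ^ k
    not-power []       k _   eq = root≢[] (trans eq ([]-^ k))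
    not-power (z ∷ zs) k 2≤k eq = period-minimal |Z|<d (Period-fromPower period-period (z ∷ zs) k eq)
      where
      d≡k*|Z| : period ≡ k * suc (length zs)
      d≡k*|Z| = trans (sym (length-applyUpTo f period)) (trans (cong length eq) (length-^ (z ∷ zs) k))
      |Z|<d : suc (length zs) < period
      |Z|<d = subst (suc (length zs) <_) (trans (*-comm (suc (length zs)) k) (sym d≡k*|Z|))
                    (m<m*n (suc (length zs)) k 2≤k)

  applyUpTo-root-power : ∀ {m} .{{_ : NonZero m}} → Period f m →
                         ∃[ k ] 1 ≤ k × applyUpTo f m ≡ root ^ k
  applyUpTo-root-power {m} f-m with period-∣ f-m
  ... | d∣m@(divides k m≡k*d) = k , >-nonZero⁻¹ k {{quotient≢0 d∣m}} ,
                                trans (cong (applyUpTo f) m≡k*d) (applyUpTo-* period-period k)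

periods⇒SameRoot : ∀ {A : Set} → DecidableEquality A →
                   ∀ {f : ℕ → A} {p q} .{{_ : NonZero p}} .{{_ : NonZero q}} →
                   Period f p → Period f q → SameRoot (applyUpTo f p) (applyUpTo f q)
periods⇒SameRoot _≟_ f-p f-q =
  root , root-primitive , applyUpTo-root-power f-p , applyUpTo-root-power f-q
  where open LeastPeriod _≟_ f-p

module _ {A : Set} {f g : ℕ → A} {p q : ℕ} .{{_ : NonZero p}} .{{_ : NonZero q}}
         (f-p : Period f p) (g-q : Period g q) where

  SameRoot⇒≗ : SameRoot (applyUpTo f p) (applyUpTo g q) → f ≗ g
  SameRoot⇒≗ (Y , (Y≢[] , _) , (k , _ , f≡Yᵏ) , (m , _ , g≡Yᵐ)) =
    Period-agree {n = p * q} {{m*n≢0 p q}} f-pq g-pq (applyUpTo-injective (p * q) f≡g)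
    where
    f-pq : Period f (p * q)
    f-pq = subst (Period f) (*-comm q p) (Period-* f-p q)
    g-pq : Period g (p * q)
    g-pq = Period-* g-q p
    f≡Y^qk : applyUpTo f (p * q) ≡ Y ^ (q * k)
    f≡Y^qk = trans (cong (applyUpTo f) (*-comm p q))
                   (trans (applyUpTo-* f-p q) (trans (cong (_^ q) f≡Yᵏ) (^-* Y k q)))
    g≡Y^pm : applyUpTo g (p * q) ≡ Y ^ (p * m)
    g≡Y^pm = trans (applyUpTo-* g-q p) (trans (cong (_^ p) g≡Yᵐ) (^-* Y m p))
    same-length : length (Y ^ (q * k)) ≡ length (Y ^ (p * m))
    same-length = begin
      length (Y ^ (q * k))           ≡⟨ cong length f≡Y^qk ⟨
      length (applyUpTo f (p * q))   ≡⟨ length-applyUpTo f (p * q) ⟩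
      p * q                          ≡⟨ length-applyUpTo g (p * q) ⟨
      length (applyUpTo g (p * q))   ≡⟨ cong length g≡Y^pm ⟩
      length (Y ^ (p * m))           ∎
      where open ≡-Reasoning
    f≡g : applyUpTo f (p * q) ≡ applyUpTo g (p * q)
    f≡g = trans f≡Y^qk (trans (^-≡-by-length Y Y≢[] (q * k) (p * m) same-length) (sym g≡Y^pm))

  ≗⇒SameRoot : DecidableEquality A → f ≗ g → SameRoot (applyUpTo f p) (applyUpTo g q)
  ≗⇒SameRoot _≟_ f≗g = subst (SameRoot (applyUpTo f p)) (applyUpTo-cong q (λ {j} _ → f≗g j))
    (periods⇒SameRoot _≟_ f-p (Period-resp-≗ (λ j → sym (f≗g j)) g-q))

module _ {A : Set} (_≺_ : A → A → Set) where

  Lexω< : (ℕ → A) → (ℕ → A) → Set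
  Lexω< a b = ∃[ n ] (∀ {m} → m < n → a m ≡ b m) × a n ≺ b n

  Lexω≤ : (ℕ → A) → (ℕ → A) → Set
  Lexω≤ a b = Lexω< a b ⊎ a ≗ b

module _ {A : Set} {_≺_ : A → A → Set} where

  Lex<-∷⁻ : ∀ {x y xs ys} → Lex< _≺_ (x ∷ xs) (y ∷ ys) → x ≺ y ⊎ (x ≡ y × Lex< _≺_ xs ys)
  Lex<-∷⁻ (here x≺y) = inj₁ x≺y
  Lex<-∷⁻ (there l)  = inj₂ (refl , l)

  Lex<-∷⁺ : ∀ {x y xs ys} → x ≡ y → Lex< _≺_ xs ys → Lex< _≺_ (x ∷ xs) (y ∷ ys)
  Lex<-∷⁺ refl = there

  Lexω<-suc : ∀ {a b : ℕ → A} → a 0 ≡ b 0 →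
              Lexω< _≺_ (λ j → a (suc j)) (λ j → b (suc j)) → Lexω< _≺_ a b
  Lexω<-suc a₀≡b₀ (n , a≡b , aₙ≺bₙ) =
    suc n , (λ { {zero} _ → a₀≡b₀ ; {suc m} (s≤s m<n) → a≡b m<n }) , aₙ≺bₙ

  Lex<-applyUpTo⇒Lexω< : ∀ (a b : ℕ → A) n →
                         Lex< _≺_ (applyUpTo a n) (applyUpTo b n) → Lexω< _≺_ a b
  Lex<-applyUpTo⇒Lexω< a b (suc n) l with Lex<-∷⁻ l
  ... | inj₁ a₀≺b₀        = 0 , (λ ()) , a₀≺b₀
  ... | inj₂ (a₀≡b₀ , l′) =
    Lexω<-suc a₀≡b₀ (Lex<-applyUpTo⇒Lexω< (λ j → a (suc j)) (λ j → b (suc j)) n l′)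

  Lexω<⇒Lex<-applyUpTo : ∀ (a b : ℕ → A) → Lexω< _≺_ a b →
                         ∃[ n ] Lex< _≺_ (applyUpTo a n) (applyUpTo b n)
  Lexω<⇒Lex<-applyUpTo a b (n , a≡b , aₙ≺bₙ) = suc n , go a b n a≡b aₙ≺bₙ
    where
    go : ∀ (a b : ℕ → A) n → (∀ {m} → m < n → a m ≡ b m) → a n ≺ b n →
         Lex< _≺_ (applyUpTo a (suc n)) (applyUpTo b (suc n))
    go a b zero    _   aₙ≺bₙ = here aₙ≺bₙ
    go a b (suc n) a≡b aₙ≺bₙ = Lex<-∷⁺ (a≡b z<s) (go _ _ n (λ m<n → a≡b (s≤s m<n)) aₙ≺bₙ)

  Lexω<-respʳ-≗ : ∀ {a b c : ℕ → A} → b ≗ c → Lexω< _≺_ a b → Lexω< _≺_ a c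
  Lexω<-respʳ-≗ b≗c (n , a≡b , aₙ≺bₙ) =
    n , (λ {m} m<n → trans (a≡b m<n) (b≗c m)) , subst (_ ≺_) (b≗c n) aₙ≺bₙ

  Lexω<-respˡ-≗ : ∀ {a b c : ℕ → A} → a ≗ b → Lexω< _≺_ a c → Lexω< _≺_ b c
  Lexω<-respˡ-≗ a≗b (n , a≡c , aₙ≺cₙ) =
    n , (λ {m} m<n → trans (sym (a≗b m)) (a≡c m<n)) , subst (_≺ _) (a≗b n) aₙ≺cₙ

  module _ (≺-trans : ∀ {x y z} → x ≺ y → y ≺ z → x ≺ z) where

    Lexω<-trans : ∀ {a b c : ℕ → A} → Lexω< _≺_ a b → Lexω< _≺_ b c → Lexω< _≺_ a c
    Lexω<-trans {a} {b} {c} (n₁ , a≡b , a≺b) (n₂ , b≡c , b≺c) with <-cmp n₁ n₂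
    ... | tri< n₁<n₂ _ _ =
      n₁ , (λ m<n → trans (a≡b m<n) (b≡c (<-trans m<n n₁<n₂))) , subst (a n₁ ≺_) (b≡c n₁<n₂) a≺b
    ... | tri≈ _ refl _  =
      n₁ , (λ m<n → trans (a≡b m<n) (b≡c m<n)) , ≺-trans a≺b b≺c
    ... | tri> _ _ n₂<n₁ =
      n₂ , (λ m<n → trans (a≡b (<-trans m<n n₂<n₁)) (b≡c m<n)) , subst (_≺ c n₂) (sym (a≡b n₂<n₁)) b≺c

    Lexω≤-trans : ∀ {a b c : ℕ → A} → Lexω≤ _≺_ a b → Lexω≤ _≺_ b c → Lexω≤ _≺_ a c
    Lexω≤-trans (inj₁ a<b) (inj₁ b<c) = inj₁ (Lexω<-trans a<b b<c)
    Lexω≤-trans (inj₁ a<b) (inj₂ b≗c) = inj₁ (Lexω<-respʳ-≗ b≗c a<b)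
    Lexω≤-trans (inj₂ a≗b) (inj₁ b<c) = inj₁ (Lexω<-respˡ-≗ (λ j → sym (a≗b j)) b<c)
    Lexω≤-trans (inj₂ a≗b) (inj₂ b≗c) = inj₂ (λ j → trans (a≗b j) (b≗c j))

  Lexω<-compareUpTo : (∀ x y → x ≺ y ⊎ x ≡ y ⊎ y ≺ x) → ∀ (a b : ℕ → A) N →
                      (∀ {t} → t < N → a t ≡ b t) ⊎ Lexω< _≺_ a b ⊎ Lexω< _≺_ b a
  Lexω<-compareUpTo compare a b zero = inj₁ (λ ())
  Lexω<-compareUpTo compare a b (suc N) with Lexω<-compareUpTo compare a b N
  ... | inj₂ a<b⊎b<a = inj₂ a<b⊎b<a
  ... | inj₁ a≡b with compare (a N) (b N)
  ...   | inj₁ aₙ≺bₙ        = inj₂ (inj₁ (N , a≡b , aₙ≺bₙ))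
  ...   | inj₂ (inj₂ bₙ≺aₙ) = inj₂ (inj₂ (N , (λ m<N → sym (a≡b m<N)) , bₙ≺aₙ))
  ...   | inj₂ (inj₁ aₙ≡bₙ) = inj₁ λ t<1+N → case m<1+n⇒m<n∨m≡n t<1+N of λ
          { (inj₁ t<N) → a≡b t<N
          ; (inj₂ refl) → aₙ≡bₙ }

<P-irrefl : ∀ {u} → ¬ u <P u
<P-irrefl (N<N n<n) = <-irrefl refl n<n

<P-trans : ∀ {u v w} → u <P v → v <P w → u <P w
<P-trans $<N      (N<N _) = $<N
<P-trans $<N      N<∞     = $<∞
<P-trans (N<N l)  (N<N m) = N<N (<-trans l m)
<P-trans (N<N _)  N<∞     = N<∞

<P-compare : ∀ u v → u <P v ⊎ u ≡ v ⊎ v <P u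
<P-compare pd$     pd$     = inj₂ (inj₁ refl)
<P-compare pd$     (pdN _) = inj₁ $<N
<P-compare pd$     pd∞     = inj₁ $<∞
<P-compare (pdN _) pd$     = inj₂ (inj₂ $<N)
<P-compare (pdN m) (pdN n) with <-cmp m n
... | tri< m<n _ _ = inj₁ (N<N m<n)
... | tri≈ _ refl _ = inj₂ (inj₁ refl)
... | tri> _ _ n<m = inj₂ (inj₂ (N<N n<m))
<P-compare (pdN _) pd∞     = inj₁ N<∞
<P-compare pd∞     pd$     = inj₂ (inj₂ $<∞)
<P-compare pd∞     (pdN _) = inj₂ (inj₂ N<∞)
<P-compare pd∞     pd∞     = inj₂ (inj₁ refl)

_≟P_ : DecidableEquality PDSym
u ≟P v with <P-compare u v
... | inj₁ u<v        = no λ { refl → <P-irrefl u<v }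
... | inj₂ (inj₁ u≡v) = yes u≡v
... | inj₂ (inj₂ v<u) = no λ { refl → <P-irrefl v<u }

cutoff : ℕ → PDSym → PDSym
cutoff b (pdN d) with d <? b
... | yes _ = pdN d
... | no  _ = pd∞
cutoff b v = v

cutoff-< : ∀ {b d} → d < b → cutoff b (pdN d) ≡ pdN d
cutoff-< {b} {d} d<b with d <? b
... | yes _   = refl
... | no  d≮b = contradiction d<b d≮b

cutoff-≥ : ∀ {b d} → b ≤ d → cutoff b (pdN d) ≡ pd∞
cutoff-≥ {b} {d} b≤d with d <? b
... | yes d<b = contradiction b≤d (<⇒≱ d<b)
... | no  _   = refl

module _ {σ : ℕ} where

  ≤S-refl : (x : Sym σ) → x ≤S x
  ≤S-refl dollar = $≤
  ≤S-refl (ch a) = ch≤ ≤-refl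

  parent-++ : ∀ (xs ys : List (Sym σ)) x k {d} →
              parent xs x k ≡ pdN d → parent (xs ++ ys) x k ≡ pdN d
  parent-++ (r ∷ xs) ys x k e with r ≤S? x
  ... | yes _ = e
  ... | no  _ = parent-++ xs ys x (suc k) e

  parent-finite : ∀ {xs : List (Sym σ)} {x} k → Any (_≤S x) xs → ∃[ d ] parent xs x k ≡ pdN d
  parent-finite {r ∷ xs} {x} k r∈xs with r ≤S? x
  ... | yes _   = k , refl
  ... | no  r≰x = parent-finite (suc k) (Any.tail r≰x r∈xs)

  cutoff-parent-≥ : ∀ (ys : List (Sym σ)) x {b} k → b ≤ k → cutoff b (parent ys x k) ≡ pd∞
  cutoff-parent-≥ []       x k b≤k = refl
  cutoff-parent-≥ (r ∷ ys) x k b≤k with r ≤S? x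
  ... | yes _ = cutoff-≥ b≤k
  ... | no  _ = cutoff-parent-≥ ys x (suc k) (m≤n⇒m≤1+n b≤k)

  cutoff-parent-++ : ∀ (xs ys : List (Sym σ)) x k →
                     cutoff (k + length xs) (parent (xs ++ ys) x k) ≡ parent xs x k
  cutoff-parent-++ []       ys x k = cutoff-parent-≥ ys x k (≤-reflexive (+-identityʳ k))
  cutoff-parent-++ (r ∷ xs) ys x k with r ≤S? x
  ... | yes _ = cutoff-< (m<m+n k z<s)
  ... | no  _ = trans (cong (λ b → cutoff b (parent (xs ++ ys) x (suc k))) (+-suc k (length xs)))
                      (cutoff-parent-++ xs ys x (suc k))

  pdSym-++ : ∀ {xs : List (Sym σ)} ys {x} → Any (_≤S x) xs → pdSym (xs ++ ys) x ≡ pdSym xs x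
  pdSym-++ {xs} ys {dollar} _      = refl
  pdSym-++ {xs} ys {ch a}   y∈xs with parent-finite 1 y∈xs
  ... | _ , found = trans (parent-++ xs ys (ch a) 1 found) (sym found)

  pdSym-cutoff : ∀ (xs ys : List (Sym σ)) x →
                 pdSym xs x ≡ cutoff (suc (length xs)) (pdSym (xs ++ ys) x)
  pdSym-cutoff xs ys dollar = refl
  pdSym-cutoff xs ys (ch a) = sym (cutoff-parent-++ xs ys (ch a) 1)

  pdAcc-∷ʳ : ∀ (rs xs : List (Sym σ)) x →
             pdAcc rs (xs ∷ʳ x) ≡ pdAcc rs xs ∷ʳ pdSym (reverseAcc rs xs) x
  pdAcc-∷ʳ rs []       x = refl
  pdAcc-∷ʳ rs (y ∷ xs) x = cong (pdSym rs y ∷_) (pdAcc-∷ʳ (y ∷ rs) xs x)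

  pdSeq : (ℕ → Sym σ) → ℕ → PDSym
  pdSeq W t = pdSym (applyDownFrom W t) (W t)

  PD-applyUpTo : ∀ W n → PD (applyUpTo W n) ≡ applyUpTo (pdSeq W) n
  PD-applyUpTo W zero    = refl
  PD-applyUpTo W (suc n) = begin
    PD (applyUpTo W (suc n))
      ≡⟨ cong PD (applyUpTo-∷ʳ W n) ⟨
    PD (applyUpTo W n ∷ʳ W n)
      ≡⟨ pdAcc-∷ʳ [] (applyUpTo W n) (W n) ⟩
    PD (applyUpTo W n) ∷ʳ pdSym (reverse (applyUpTo W n)) (W n)
      ≡⟨ cong₂ (λ xs h → xs ∷ʳ pdSym h (W n)) (PD-applyUpTo W n) (reverse-applyUpTo W n) ⟩
    applyUpTo (pdSeq W) n ∷ʳ pdSeq W n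
      ≡⟨ applyUpTo-∷ʳ (pdSeq W) n ⟩
    applyUpTo (pdSeq W) (suc n)
      ∎
    where open ≡-Reasoning

module PeriodicWord {σ : ℕ} {W : ℕ → Sym σ} {p : ℕ} .{{_ : NonZero p}} (W-p : Period W p) where

  rpdSeq : ℕ → PDSym
  rpdSeq t = pdSeq W (p + t)

  history-period : ∀ t → applyDownFrom W (p + t) ≡ applyDownFrom W t ++ applyDownFrom W p
  history-period t = begin
    applyDownFrom W (p + t)                                ≡⟨ cong (applyDownFrom W) (+-comm p t) ⟩
    applyDownFrom W (t + p)                                ≡⟨ applyDownFrom-+ W t p ⟩
    applyDownFrom (λ j → W (p + j)) t ++ applyDownFrom W p ≡⟨ cong (_++ _) (applyDownFrom-cong W-p t) ⟩
    applyDownFrom W t ++ applyDownFrom W p                 ∎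
    where open ≡-Reasoning

  pdSeq-cutoff : ∀ t → pdSeq W t ≡ cutoff (suc t) (rpdSeq t)
  pdSeq-cutoff t = begin
    pdSym (applyDownFrom W t) (W t)
      ≡⟨ pdSym-cutoff (applyDownFrom W t) (applyDownFrom W p) (W t) ⟩
    cutoff (suc (length (applyDownFrom W t))) (pdSym (applyDownFrom W t ++ applyDownFrom W p) (W t))
      ≡⟨ cong₂ (λ n h → cutoff (suc n) (pdSym h (W t))) (length-applyDownFrom W t) (sym (history-period t)) ⟩
    cutoff (suc t) (pdSym (applyDownFrom W (p + t)) (W t))
      ≡⟨ cong (λ x → cutoff (suc t) (pdSym (applyDownFrom W (p + t)) x)) (W-p t) ⟨
    cutoff (suc t) (rpdSeq t)
      ∎
    where open ≡-Reasoning

  rpdSeq-period : Period rpdSeq p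
  rpdSeq-period u = begin
    pdSym (applyDownFrom W (p + (p + u))) (W (p + (p + u)))
      ≡⟨ cong₂ pdSym history-2p (trans (W-p (p + u)) (W-p u)) ⟩
    pdSym (block ++ applyDownFrom W (p + u)) (W u)
      ≡⟨ pdSym-++ _ Wu∈block ⟩
    pdSym block (W u)
      ≡⟨ pdSym-++ _ Wu∈block ⟨
    pdSym (block ++ applyDownFrom W u) (W u)
      ≡⟨ cong₂ pdSym (applyDownFrom-+ W p u) (W-p u) ⟨
    pdSym (applyDownFrom W (p + u)) (W (p + u))
      ∎
    where
    open ≡-Reasoning
    block : List (Sym σ)
    block = applyDownFrom (λ j → W (u + j)) p
    history-2p : applyDownFrom W (p + (p + u)) ≡ block ++ applyDownFrom W (p + u)
    history-2p = trans (applyDownFrom-+ W p (p + u)) (cong (_++ applyDownFrom W (p + u))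
      (applyDownFrom-cong (λ j → trans (cong W (+-assoc p u j)) (W-p (u + j))) p))
    Wu∈block : Any (_≤S W u) block
    Wu∈block = applyDownFrom⁺ (λ j → W (u + j))
      (subst (λ i → W i ≤S W u) (sym (+-identityʳ u)) (≤S-refl (W u))) (>-nonZero⁻¹ p)

  rpdSeq≡pdSeq : ∀ {t} → p ≤ t → rpdSeq t ≡ pdSeq W t
  rpdSeq≡pdSeq p≤t = subst (λ t → rpdSeq t ≡ pdSeq W t) (m+[n∸m]≡n p≤t) (rpdSeq-period (_ ∸ p))

  RPD-applyUpTo : RPD (applyUpTo W p) ≡ applyUpTo rpdSeq p
  RPD-applyUpTo = begin
    drop (length (applyUpTo W p)) (PD (applyUpTo W p ++ applyUpTo W p))
      ≡⟨ cong₂ (λ n xs → drop n (PD xs)) (length-applyUpTo W p) W²≡ ⟩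
    drop p (PD (applyUpTo W (p + p)))
      ≡⟨ cong (drop p) (PD-applyUpTo W (p + p)) ⟩
    drop p (applyUpTo (pdSeq W) (p + p))
      ≡⟨ drop-applyUpTo (pdSeq W) p p ⟩
    applyUpTo rpdSeq p
      ∎
    where
    open ≡-Reasoning
    W²≡ : applyUpTo W p ++ applyUpTo W p ≡ applyUpTo W (p + p)
    W²≡ = sym (trans (applyUpTo-+ W p p) (cong (applyUpTo W p ++_) (applyUpTo-cong p (λ {j} _ → W-p j))))

module _ {σ : ℕ} where

  module ωWord (V : List⁺ (Sym σ)) = PeriodicWord (cycle-period V)
  open ωWord using (rpdSeq; rpdSeq-period; rpdSeq≡pdSeq; pdSeq-cutoff)

  pdω : List⁺ (Sym σ) → ℕ → PDSym
  pdω V = pdSeq (cycle V)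

  PD-ωprefix : ∀ V i → PD (ωprefix V i) ≡ applyUpTo (pdω V) i
  PD-ωprefix V i = begin
    PD (take i (toList V ^ i))                  ≡⟨ cong (λ xs → PD (take i (xs ^ i))) (applyUpTo-cycle V) ⟨
    PD (take i (applyUpTo (cycle V) ∣V∣ ^ i))   ≡⟨ cong (PD ∘ take i) (applyUpTo-* (cycle-period V) i) ⟨
    PD (take i (applyUpTo (cycle V) (i * ∣V∣))) ≡⟨ cong PD (take-applyUpTo (cycle V) (m≤m*n i ∣V∣)) ⟩
    PD (applyUpTo (cycle V) i)                  ≡⟨ PD-applyUpTo (cycle V) i ⟩
    applyUpTo (pdω V) i                         ∎
    where
    open ≡-Reasoning
    ∣V∣ = List⁺.length V

  RPD-rpdSeq : ∀ V → RPD (toList V) ≡ applyUpTo (rpdSeq V) (List⁺.length V)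
  RPD-rpdSeq V = trans (cong RPD (sym (applyUpTo-cycle V))) (ωWord.RPD-applyUpTo V)

  SameRoot-RPD⇒pdω-≗ : ∀ {V U} → SameRoot (RPD (toList V)) (RPD (toList U)) → pdω V ≗ pdω U
  SameRoot-RPD⇒pdω-≗ {V} {U} sr t = begin
    pdω V t                        ≡⟨ pdSeq-cutoff V t ⟩
    cutoff (suc t) (rpdSeq V t)    ≡⟨ cong (cutoff (suc t)) (rpd≗ t) ⟩
    cutoff (suc t) (rpdSeq U t)    ≡⟨ pdSeq-cutoff U t ⟨
    pdω U t                        ∎
    where
    open ≡-Reasoning
    rpd≗ : rpdSeq V ≗ rpdSeq U
    rpd≗ = SameRoot⇒≗ (rpdSeq-period V) (rpdSeq-period U)
                      (subst₂ SameRoot (RPD-rpdSeq V) (RPD-rpdSeq U) sr)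

  -- K = |V||U| is a common period of r_V and r_U with K ≥ |V|, |U|, so agreement of s_V and s_U
  -- on [K, 2K) is agreement of r_V and r_U on a whole common period.
  horizon : List⁺ (Sym σ) → List⁺ (Sym σ) → ℕ
  horizon V U = List⁺.length V * List⁺.length U + List⁺.length V * List⁺.length U

  pdω-agree⇒SameRoot-RPD : ∀ {V U} → (∀ {t} → t < horizon V U → pdω V t ≡ pdω U t) →
                           SameRoot (RPD (toList V)) (RPD (toList U))
  pdω-agree⇒SameRoot-RPD {V} {U} agree = subst₂ SameRoot (sym (RPD-rpdSeq V)) (sym (RPD-rpdSeq U))
    (≗⇒SameRoot (rpdSeq-period V) (rpdSeq-period U) _≟P_ rpd≗)
    where
    open ≡-Reasoning
    ∣V∣ = List⁺.length V
    ∣U∣ = List⁺.length U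
    K = ∣V∣ * ∣U∣
    V-K : Period (rpdSeq V) K
    V-K = subst (Period (rpdSeq V)) (*-comm ∣U∣ ∣V∣) (Period-* (rpdSeq-period V) ∣U∣)
    U-K : Period (rpdSeq U) K
    U-K = Period-* (rpdSeq-period U) ∣V∣
    below : ∀ {j} → j < K → rpdSeq V j ≡ rpdSeq U j
    below {j} j<K = begin
      rpdSeq V j        ≡⟨ V-K j ⟨
      rpdSeq V (K + j)  ≡⟨ rpdSeq≡pdSeq V (≤-trans (m≤m*n ∣V∣ ∣U∣) (m≤m+n K j)) ⟩
      pdω V (K + j)     ≡⟨ agree (+-monoʳ-< K j<K) ⟩
      pdω U (K + j)     ≡⟨ rpdSeq≡pdSeq U (≤-trans (m≤n*m ∣U∣ ∣V∣) (m≤m+n K j)) ⟨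
      rpdSeq U (K + j)  ≡⟨ U-K j ⟩
      rpdSeq U j        ∎
    rpd≗ : rpdSeq V ≗ rpdSeq U
    rpd≗ = Period-agree {n = K} {{m*n≢0 ∣V∣ ∣U∣}} V-K U-K below

  ⪯ω⇒Lexω≤ : ∀ {V U} → V ⪯ω U → Lexω≤ _<P_ (pdω V) (pdω U)
  ⪯ω⇒Lexω≤ {V} {U} (inj₁ (i , l)) =
    inj₁ (Lex<-applyUpTo⇒Lexω< (pdω V) (pdω U) i
           (subst₂ (Lex< _<P_) (PD-ωprefix V i) (PD-ωprefix U i) l))
  ⪯ω⇒Lexω≤ (inj₂ sr) = inj₂ (SameRoot-RPD⇒pdω-≗ sr)

  Lexω<⇒⪯ω : ∀ {V U} → Lexω< _<P_ (pdω V) (pdω U) → V ⪯ω U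
  Lexω<⇒⪯ω {V} {U} l with Lexω<⇒Lex<-applyUpTo (pdω V) (pdω U) l
  ... | i , l′ = inj₁ (i , subst₂ (Lex< _<P_) (sym (PD-ωprefix V i)) (sym (PD-ωprefix U i)) l′)

  Lexω≤⇒⪯ω : ∀ {V U} → Lexω≤ _<P_ (pdω V) (pdω U) → V ⪯ω U
  Lexω≤⇒⪯ω (inj₁ l)   = Lexω<⇒⪯ω l
  Lexω≤⇒⪯ω (inj₂ V≗U) = inj₂ (pdω-agree⇒SameRoot-RPD (λ {t} _ → V≗U t))

  ⪯ω-refl : ∀ {V} → V ⪯ω V
  ⪯ω-refl {V} = Lexω≤⇒⪯ω {V} (inj₂ (λ _ → refl))

  ⪯ω-trans : ∀ {V U X} → V ⪯ω U → U ⪯ω X → V ⪯ω X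
  ⪯ω-trans {V} {U} {X} V⪯U U⪯X =
    Lexω≤⇒⪯ω {V} {X} (Lexω≤-trans {_≺_ = _<P_} <P-trans (⪯ω⇒Lexω≤ V⪯U) (⪯ω⇒Lexω≤ U⪯X))

  ⪯ω-total : ∀ V U → V ⪯ω U ⊎ U ⪯ω V
  ⪯ω-total V U with Lexω<-compareUpTo <P-compare (pdω V) (pdω U) (horizon V U)
  ... | inj₁ agree       = inj₁ (inj₂ (pdω-agree⇒SameRoot-RPD agree))
  ... | inj₂ (inj₁ V<U)  = inj₁ (Lexω<⇒⪯ω V<U)
  ... | inj₂ (inj₂ U<V)  = inj₂ (Lexω<⇒⪯ω U<V)

corollary4 : (σ : ℕ) → IsTotalPreorder {A = List⁺ (Sym σ)} _≡_ (_⪯ω_ {σ})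
corollary4 σ = record
  { isPreorder = record
    { isEquivalence = isEquivalence
    ; reflexive     = λ { refl → ⪯ω-refl }
    ; trans         = ⪯ω-trans
    }
  ; total = ⪯ω-total
  }
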